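{- Let $n\geq 4$ and $i\in[1,n]$. Let $R^i_{\Lambda_n}$ (respectively $L^i_{\Lambda_n}$) be the set of ordered pairs $(e,e')$ of edges of $\Lambda_n$ such that $e=\{x,y\}$ uses direction $i$ with lower endpoint $y$ and upper endpoint $x=y+\delta_i$, and $e'=\{y,y+\delta_{\mathbf{i+1}}\}$ (respectively $e'=\{y,y+\delta_{\mathbf{i-1}}\}$) is an edge of $\Lambda_n$ which is an imbalanced edge for $e$. Then there is a bijection between $R^i_{\Lambda_n}$ and the set of Fibonacci strings of length $n-4$, and there is a bijection between $L^i_{\Lambda_n}$ and the set of Fibonacci strings of length $n-4$.
   Context: The hypercube $Q_n$ has vertex set the binary strings of length $n$, adjacency meaning differing in exactly one position. For $x=x_1\ldots x_n$, $x+\delta_i$ is $x$ with its $i$-th coordinate complemented; the edge $\{x,x+\delta_i\}$ uses direction $i$, its endpoint with $i$-th coordinate 1 is the upper endpoint and the other is the lower endpoint. A Fibonacci string is a binary string with no two consecutive 1's. A Lucas string of length $n$ is a Fibonacci string $b_1\ldots b_n$ with $b_1b_n\neq 1$ (i.e. no two cyclically consecutive 1's); the Lucas cube $\Lambda_n$ is the subgraph of $Q_n$ induced by Lucas strings of length $n$. For an integer $k$, $\mathbf{k}=((k-1)\bmod n)+1\in[1,n]$ (cyclic index). An edge $e'=\{y,y+\delta_j\}$ of $\Lambda_n$ at the lower endpoint $y$ of an edge $e=\{x,y\}$ is an imbalanced edge for $e$ if $x+\delta_j$ is not a Lucas string. -}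

module Defs where

open import Data.Nat using (ℕ; zero; suc; _∸_)
open import Data.Bool using (Bool; true; false; not; _∧_; _∨_)
open import Data.Fin using (Fin; zero; suc; toℕ; fromℕ<)
open import Data.Fin.Properties using (_≟_)
open import Data.Vec using (Vec; []; _∷_; lookup; updateAt; head; last)
open import Data.Product using (Σ; _×_; _,_)
open import Relation.Binary.PropositionalEquality using (_≡_)
open import Relation.Nullary using (¬_)
open import Data.Nat.DivMod using (_%_; m%n<n)

-- Binary strings of length n: Vec Bool n (true = 1). Positions are 0-based
-- (Fin n), i.e. position p corresponds to the paper's index p+1.

noConsec11 : ∀ {n} → Vec Bool n → Bool
noConsec11 [] = true
noConsec11 (a ∷ []) = true
noConsec11 (a ∷ b ∷ xs) = not (a ∧ b) ∧ noConsec11 (b ∷ xs)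

IsFibonacci : ∀ {n} → Vec Bool n → Set
IsFibonacci x = noConsec11 x ≡ true

lucasB : ∀ {n} → Vec Bool n → Bool
lucasB [] = true
lucasB {suc n} x = noConsec11 x ∧ not (head x ∧ last x)

IsLucas : ∀ {n} → Vec Bool n → Set
IsLucas x = lucasB x ≡ true

flip : ∀ {n} → Vec Bool n → Fin n → Vec Bool n
flip x i = updateAt x i not

Fib : ℕ → Set
Fib m = Σ (Vec Bool m) IsFibonacci

LucasVertex : ℕ → Set
LucasVertex n = Σ (Vec Bool n) IsLucas

-- An edge of Λ_n, represented canonically by its lower endpoint y and its
-- direction d: y has d-th coordinate 0, and both y and y+δ_d are Lucas
-- strings (the upper endpoint is y+δ_d).
record Edge (n : ℕ) : Set where
  constructor edge
  field
    lower     : Vec Bool n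
    dir       : Fin n
    lower-0   : lookup lower dir ≡ false
    lower-Λ   : IsLucas lower
    upper-Λ   : IsLucas (flip lower dir)

upper : ∀ {n} → Edge n → Vec Bool n
upper e = flip (Edge.lower e) (Edge.dir e)

cycSuc : ∀ {n} → Fin n → Fin n
cycSuc {suc n} i = fromℕ< (m%n<n (suc (toℕ i)) (suc n))

cycPred : ∀ {n} → Fin n → Fin n
cycPred {suc n} i = fromℕ< (m%n<n (toℕ i + n) (suc n))
  where open Data.Nat using (_+_)

-- e' is an edge of Λ_n at the vertex y (one of its endpoints is y) in
-- direction j.  Since e' = {y, y+δ_j}, y is either its lower or upper endpoint.
EdgeAt : ∀ {n} → Vec Bool n → Fin n → Edge n → Set
EdgeAt y j e' = (Edge.dir e' ≡ j) × ((Edge.lower e' ≡ y) Data.Sum.⊎ (upper e' ≡ y))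
  where import Data.Sum

-- Imbalanced edge e' = {y, y+δ_j} for e = {x,y} (y lower endpoint of e):
-- x + δ_j is not a Lucas string (stated as the Boolean test being false,
-- equivalent to ¬ IsLucas, chosen so that the proof component is a
-- proposition without function extensionality).
Imbalanced : ∀ {n} → Edge n → Edge n → Set
Imbalanced e e' = EdgeAt (Edge.lower e) (Edge.dir e') e'
                × (lucasB (flip (upper e) (Edge.dir e')) ≡ false)

Rset : (n : ℕ) → Fin n → Set
Rset n i = Σ (Edge n) λ e → Σ (Edge n) λ e' →
  (Edge.dir e ≡ i) × EdgeAt (Edge.lower e) (cycSuc i) e' × Imbalanced e e'

Lset : (n : ℕ) → Fin n → Set
Lset n i = Σ (Edge n) λ e → Σ (Edge n) λ e' →
  (Edge.dir e ≡ i) × EdgeAt (Edge.lower e) (cycPred i) e' × Imbalanced e e'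

module Submission where

-- A pair (e, e′) of R^i or L^i is determined by the common lower endpoint y,
-- and such a pair exists exactly when y is the lower endpoint of Λ_n-edges in
-- two cyclically adjacent directions p and p+1.  Indeed y is not the upper
-- endpoint of e′, since y+δ_p being a Lucas string forces y_{p+1} = 0, and
-- imbalance is automatic, since y+δ_p+δ_{p+1} has 1's at p and p+1.  These y
-- are the Lucas strings vanishing at p−1, p, p+1 and p+2.  Rotating strings by
-- one place identifies the sets for (p+1, p+2) and (p, p+1), and for (1, 2)
-- the strings are 0000z with z an arbitrary Fibonacci string of length n−4.

open import Defs
open import Data.Nat using (ℕ; zero; suc; _+_; _≤_; _∸_; s≤s)
open import Data.Nat.Properties using (≤-refl; <⇒≤; +-suc; 1+n≢n)
open import Data.Nat.DivMod using (_%_; m≤n⇒m%n≡m; n%n≡0; [m+n]%n≡m%n)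
open import Data.Fin using (Fin; zero; suc; toℕ; fromℕ; inject₁)
open import Data.Fin.Properties using (toℕ-injective; toℕ-fromℕ<; toℕ-fromℕ; toℕ-inject₁; toℕ<n)
open import Data.Fin.Induction using (<-weakInduction)
open import Data.Fin.Relation.Unary.Top using (view; ‵fromℕ; ‵inject₁)
open import Data.Bool using (Bool; true; false; not; _∧_)
open import Data.Bool.Properties using (∧-comm; ∧-assoc; ∧-identityʳ; ∧-commutativeMonoid; ¬-not)
import Data.Bool.Properties as Bool
open import Data.Vec using (Vec; []; _∷_; _∷ʳ_; lookup; updateAt; init; last; initLast)
open import Data.Vec.Properties using (init-∷ʳ; last-∷ʳ; lookup∘updateAt; lookup∘updateAt′)
open import Data.Product using (Σ; _×_; _,_; proj₂; map₂; swap)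
open import Data.Product.Function.Dependent.Propositional using (Σ-↔)
open import Data.Sum using (_⊎_; inj₁; inj₂) renaming (swap to ⊎-swap)
open import Data.Empty using (⊥-elim)
open import Function.Bundles using (_⤖_; _↔_; mk↔ₛ′)
open import Function.Properties.Inverse using (↔-refl; ↔-sym; ↔-trans; ↔⇒⤖)
open import Axiom.UniquenessOfIdentityProofs using (module Decidable⇒UIP)
open import Algebra.Bundles using (CommutativeMonoid)
open import Algebra.Properties.CommutativeSemigroup
  (CommutativeMonoid.commutativeSemigroup ∧-commutativeMonoid) using (xy∙z≈zx∙y)
open import Relation.Binary.PropositionalEquality
open import Relation.Nullary using (contradiction)

private
  variable
    A : Set
    k n : ℕ

Bool-uip : {a b : Bool} (p q : a ≡ b) → p ≡ q
Bool-uip = Decidable⇒UIP.≡-irrelevant Bool._≟_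

toℕ-cycSuc : (p : Fin (suc k)) → toℕ (cycSuc p) ≡ suc (toℕ p) % suc k
toℕ-cycSuc p = toℕ-fromℕ< _

toℕ-cycPred : (p : Fin (suc k)) → toℕ (cycPred p) ≡ (toℕ p + k) % suc k
toℕ-cycPred p = toℕ-fromℕ< _

cycSuc-inject₁ : (q : Fin k) → cycSuc (inject₁ q) ≡ suc q
cycSuc-inject₁ {k} q = toℕ-injective (begin
  toℕ (cycSuc (inject₁ q))      ≡⟨ toℕ-cycSuc (inject₁ q) ⟩
  suc (toℕ (inject₁ q)) % suc k ≡⟨ cong (λ t → suc t % suc k) (toℕ-inject₁ q) ⟩
  suc (toℕ q) % suc k           ≡⟨ m≤n⇒m%n≡m (toℕ<n q) ⟩
  suc (toℕ q)                   ∎)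
  where open ≡-Reasoning

cycSuc-fromℕ : ∀ k → cycSuc (fromℕ k) ≡ zero
cycSuc-fromℕ k = toℕ-injective (begin
  toℕ (cycSuc (fromℕ k))      ≡⟨ toℕ-cycSuc (fromℕ k) ⟩
  suc (toℕ (fromℕ k)) % suc k ≡⟨ cong (λ t → suc t % suc k) (toℕ-fromℕ k) ⟩
  suc k % suc k               ≡⟨ n%n≡0 (suc k) ⟩
  0                           ∎)
  where open ≡-Reasoning

cycPred-zero : cycPred {suc k} zero ≡ fromℕ k
cycPred-zero {k} = toℕ-injective (begin
  toℕ (cycPred {suc k} zero) ≡⟨ toℕ-cycPred zero ⟩
  k % suc k                  ≡⟨ m≤n⇒m%n≡m ≤-refl ⟩
  k                          ≡⟨ toℕ-fromℕ k ⟨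
  toℕ (fromℕ k)              ∎)
  where open ≡-Reasoning

cycPred-suc : (q : Fin k) → cycPred (suc q) ≡ inject₁ q
cycPred-suc {k} q = toℕ-injective (begin
  toℕ (cycPred (suc q))     ≡⟨ toℕ-cycPred (suc q) ⟩
  (suc (toℕ q) + k) % suc k ≡⟨ cong (_% suc k) (+-suc (toℕ q) k) ⟨
  (toℕ q + suc k) % suc k   ≡⟨ [m+n]%n≡m%n (toℕ q) (suc k) ⟩
  toℕ q % suc k             ≡⟨ m≤n⇒m%n≡m (<⇒≤ (toℕ<n q)) ⟩
  toℕ q                     ≡⟨ toℕ-inject₁ q ⟨
  toℕ (inject₁ q)           ∎)
  where open ≡-Reasoning

cycSuc-cycPred : (i : Fin n) → cycSuc (cycPred i) ≡ i
cycSuc-cycPred {suc k} zero    = trans (cong cycSuc cycPred-zero) (cycSuc-fromℕ k)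
cycSuc-cycPred {suc k} (suc q) = trans (cong cycSuc (cycPred-suc q)) (cycSuc-inject₁ q)

cycSuc-≢ : (p : Fin (suc (suc k))) → cycSuc p ≢ p
cycSuc-≢ {k} p with view p
... | ‵fromℕ     rewrite cycSuc-fromℕ (suc k) = λ ()
... | ‵inject₁ q rewrite cycSuc-inject₁ q    = λ eq → 1+n≢n (trans (cong toℕ eq) (toℕ-inject₁ q))

cycSuc-induction : (P : Fin (suc k) → Set) → P zero → (∀ p → P p → P (cycSuc p)) → ∀ p → P p
cycSuc-induction P P₀ step =
  <-weakInduction P P₀ (λ q Pq → subst P (cycSuc-inject₁ q) (step (inject₁ q) Pq))

Adjacent : Fin n → Fin n → Set
Adjacent p q = cycSuc p ≡ q ⊎ cycSuc q ≡ p

Adjacent-sym : {p q : Fin n} → Adjacent p q → Adjacent q p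
Adjacent-sym = ⊎-swap

Adjacent-≢ : {p q : Fin (suc (suc k))} → Adjacent p q → p ≢ q
Adjacent-≢ {p = p} (inj₁ sp≡q) refl = cycSuc-≢ p sp≡q
Adjacent-≢ {p = p} (inj₂ sq≡p) refl = cycSuc-≢ p sq≡p

rotate : Vec A n → Vec A n
rotate []       = []
rotate (a ∷ xs) = xs ∷ʳ a

unrotate : Vec A n → Vec A n
unrotate {n = zero}  v = v
unrotate {n = suc _} v = last v ∷ init v

rotate-unrotate : (v : Vec A n) → rotate (unrotate v) ≡ v
rotate-unrotate {n = zero}  [] = refl
rotate-unrotate {n = suc _} v  = sym (proj₂ (proj₂ (initLast v)))

unrotate-rotate : (v : Vec A n) → unrotate (rotate v) ≡ v
unrotate-rotate []       = refl
unrotate-rotate (a ∷ xs) = cong₂ _∷_ (last-∷ʳ a xs) (init-∷ʳ a xs)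

rotate-↔ : Vec A n ↔ Vec A n
rotate-↔ = mk↔ₛ′ rotate unrotate rotate-unrotate unrotate-rotate

lookup-∷ʳ-inject₁ : (xs : Vec A k) (a : A) (q : Fin k) → lookup (xs ∷ʳ a) (inject₁ q) ≡ lookup xs q
lookup-∷ʳ-inject₁ (x ∷ xs) a zero    = refl
lookup-∷ʳ-inject₁ (x ∷ xs) a (suc q) = lookup-∷ʳ-inject₁ xs a q

lookup-∷ʳ-fromℕ : (xs : Vec A k) (a : A) → lookup (xs ∷ʳ a) (fromℕ k) ≡ a
lookup-∷ʳ-fromℕ []       a = refl
lookup-∷ʳ-fromℕ (x ∷ xs) a = lookup-∷ʳ-fromℕ xs a

updateAt-∷ʳ-inject₁ : (xs : Vec A k) (a : A) (q : Fin k) (f : A → A) →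
                      updateAt (xs ∷ʳ a) (inject₁ q) f ≡ updateAt xs q f ∷ʳ a
updateAt-∷ʳ-inject₁ (x ∷ xs) a zero    f = refl
updateAt-∷ʳ-inject₁ (x ∷ xs) a (suc q) f = cong (x ∷_) (updateAt-∷ʳ-inject₁ xs a q f)

updateAt-∷ʳ-fromℕ : (xs : Vec A k) (a : A) (f : A → A) → updateAt (xs ∷ʳ a) (fromℕ k) f ≡ xs ∷ʳ f a
updateAt-∷ʳ-fromℕ []       a f = refl
updateAt-∷ʳ-fromℕ (x ∷ xs) a f = cong (x ∷_) (updateAt-∷ʳ-fromℕ xs a f)

lookup-rotate : (v : Vec A n) (p : Fin n) → lookup (rotate v) p ≡ lookup v (cycSuc p)
lookup-rotate {n = suc k} (a ∷ xs) p with view p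
... | ‵inject₁ q rewrite cycSuc-inject₁ q = lookup-∷ʳ-inject₁ xs a q
... | ‵fromℕ     rewrite cycSuc-fromℕ k  = lookup-∷ʳ-fromℕ xs a

updateAt-rotate : (v : Vec A n) (p : Fin n) (f : A → A) →
                  updateAt (rotate v) p f ≡ rotate (updateAt v (cycSuc p) f)
updateAt-rotate {n = suc k} (a ∷ xs) p f with view p
... | ‵inject₁ q rewrite cycSuc-inject₁ q = updateAt-∷ʳ-inject₁ xs a q f
... | ‵fromℕ     rewrite cycSuc-fromℕ k  = updateAt-∷ʳ-fromℕ xs a f

noConsec11-∷ʳ : (b : Bool) (ys : Vec Bool k) (a : Bool) →
                noConsec11 ((b ∷ ys) ∷ʳ a) ≡ noConsec11 (b ∷ ys) ∧ not (last (b ∷ ys) ∧ a)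
noConsec11-∷ʳ b []       a = ∧-identityʳ (not (b ∧ a))
noConsec11-∷ʳ b (c ∷ zs) a = trans (cong (not (b ∧ c) ∧_) (noConsec11-∷ʳ c zs a))
  (sym (∧-assoc (not (b ∧ c)) (noConsec11 (c ∷ zs)) (not (last (c ∷ zs) ∧ a))))

lucasB-rotate : (v : Vec Bool n) → lucasB (rotate v) ≡ lucasB v
lucasB-rotate []           = refl
lucasB-rotate (a ∷ [])     = refl
lucasB-rotate (a ∷ b ∷ ys) = begin
  noConsec11 ((b ∷ ys) ∷ʳ a) ∧ not (b ∧ last ((b ∷ ys) ∷ʳ a))
    ≡⟨ cong₂ (λ u v → u ∧ not (b ∧ v)) (noConsec11-∷ʳ b ys a) (last-∷ʳ a (b ∷ ys)) ⟩
  (N ∧ not (L ∧ a)) ∧ not (b ∧ a)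
    ≡⟨ xy∙z≈zx∙y N (not (L ∧ a)) (not (b ∧ a)) ⟩
  (not (b ∧ a) ∧ N) ∧ not (L ∧ a)
    ≡⟨ cong₂ (λ u v → (not u ∧ N) ∧ not v) (∧-comm b a) (∧-comm L a) ⟩
  (not (a ∧ b) ∧ N) ∧ not (a ∧ L)
    ∎
  where
  open ≡-Reasoning
  N = noConsec11 (b ∷ ys)
  L = last (b ∷ ys)

lucasB-cycSuc-ones : (x : Vec Bool n) (p : Fin n) →
                     lookup x p ≡ true → lookup x (cycSuc p) ≡ true → lucasB x ≡ false
lucasB-cycSuc-ones {suc k} x p = cycSuc-induction P base step p x
  where
  P : Fin (suc k) → Set
  P p = ∀ x → lookup x p ≡ true → lookup x (cycSuc p) ≡ true → lucasB x ≡ false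
  base : P zero
  base (true ∷ [])     refl _    = refl
  base (true ∷ _ ∷ _)  refl refl = refl
  step : ∀ p → P p → P (cycSuc p)
  step p Pp x xp xsp = begin
    lucasB x          ≡⟨ lucasB-rotate x ⟨
    lucasB (rotate x) ≡⟨ Pp (rotate x) (trans (lookup-rotate x p) xp)
                                        (trans (lookup-rotate x (cycSuc p)) xsp) ⟩
    false             ∎
    where open ≡-Reasoning

lucasB-Adjacent-ones : {p q : Fin n} (x : Vec Bool n) → Adjacent p q →
                       lookup x p ≡ true → lookup x q ≡ true → lucasB x ≡ false
lucasB-Adjacent-ones {p = p} x (inj₁ refl) xp xq = lucasB-cycSuc-ones x p xp xq
lucasB-Adjacent-ones {q = q} x (inj₂ refl) xp xq = lucasB-cycSuc-ones x q xq xp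

lookup-flip-≢ : {p q : Fin n} (y : Vec Bool n) → q ≢ p → lookup (flip y p) q ≡ lookup y q
lookup-flip-≢ {p = p} {q} y q≢p = lookup∘updateAt′ q p q≢p y

lookup-flip-false : {p : Fin n} (y : Vec Bool n) → lookup y p ≡ false → lookup (flip y p) p ≡ true
lookup-flip-false {p = p} y yp = trans (lookup∘updateAt p y) (cong not yp)

LowerEnd : Vec Bool n → Fin n → Set
LowerEnd y d = (lookup y d ≡ false) × IsLucas y × IsLucas (flip y d)

LowerEnd-irrelevant : {y : Vec Bool n} {d : Fin n} (u v : LowerEnd y d) → u ≡ v
LowerEnd-irrelevant (a , b , c) (a′ , b′ , c′) =
  cong₂ _,_ (Bool-uip a a′) (cong₂ _,_ (Bool-uip b b′) (Bool-uip c c′))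

LowerEnd-neighbour : {i j : Fin (suc (suc k))} (y : Vec Bool (suc (suc k))) →
                     Adjacent i j → LowerEnd y i → lookup y j ≡ false
LowerEnd-neighbour {i = i} {j} y adj (yi , _ , flipΛ) = ¬-not λ yj →
  contradiction (trans (sym flipΛ)
    (lucasB-Adjacent-ones (flip y i) adj (lookup-flip-false y yi)
      (trans (lookup-flip-≢ y (Adjacent-≢ (Adjacent-sym adj))) yj))) λ ()

flip-flip-Adjacent-not-Lucas : {i j : Fin (suc (suc k))} (y : Vec Bool (suc (suc k))) →
  Adjacent i j → lookup y i ≡ false → lookup y j ≡ false → lucasB (flip (flip y i) j) ≡ false
flip-flip-Adjacent-not-Lucas {i = i} {j} y adj yi yj =
  lucasB-Adjacent-ones (flip (flip y i) j) adj
  (trans (lookup-flip-≢ (flip y i) (Adjacent-≢ adj)) (lookup-flip-false y yi))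
  (lookup-flip-false (flip y i) (trans (lookup-flip-≢ y (Adjacent-≢ (Adjacent-sym adj))) yj))

LowerEnds : (n : ℕ) → Fin n → Fin n → Set
LowerEnds n p q = Σ (Vec Bool n) λ y → LowerEnd y p × LowerEnd y q

LowerEnds-≡ : {p q : Fin n} {y : Vec Bool n} (u v : LowerEnd y p × LowerEnd y q) →
              _≡_ {A = LowerEnds n p q} (y , u) (y , v)
LowerEnds-≡ {p = p} {q} {y} (u , u′) (v , v′) = cong (y ,_)
  (cong₂ _,_ (LowerEnd-irrelevant {y = y} {p} u v) (LowerEnd-irrelevant {y = y} {q} u′ v′))

LowerEnds-swap : {p q : Fin n} → LowerEnds n p q ↔ LowerEnds n q p
LowerEnds-swap = mk↔ₛ′ (map₂ swap) (map₂ swap) (λ _ → refl) (λ _ → refl)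

ImbalancedPairs : (n : ℕ) → Fin n → Fin n → Set
ImbalancedPairs n i j = Σ (Edge n) λ e → Σ (Edge n) λ e′ →
  (Edge.dir e ≡ i) × EdgeAt (Edge.lower e) j e′ × Imbalanced e e′

upper-≢ : (e : Edge n) {y : Vec Bool n} → lookup y (Edge.dir e) ≡ false → upper e ≢ y
upper-≢ (edge y d y0 _ _) upper-0 refl =
  contradiction (trans (sym upper-0) (lookup-flip-false y y0)) λ ()

ImbalancedPairs↔LowerEnds : {i j : Fin (suc (suc k))} → Adjacent i j →
                            ImbalancedPairs (suc (suc k)) i j ↔ LowerEnds (suc (suc k)) i j
ImbalancedPairs↔LowerEnds {i = i} {j} adj = mk↔ₛ′ to from (λ _ → refl) from∘to
  where
  to : ImbalancedPairs _ i j → LowerEnds _ i j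
  to (edge y _ yi Λ Λi , edge _ _ yj Λ′ Λj , refl , (refl , inj₁ refl) , _) =
    y , (yi , Λ , Λi) , (yj , Λ′ , Λj)
  to (edge y _ yi Λ Λi , e′ , refl , (refl , inj₂ up) , _) =
    ⊥-elim (upper-≢ e′ (LowerEnd-neighbour y adj (yi , Λ , Λi)) up)
  from : LowerEnds _ i j → ImbalancedPairs _ i j
  from (y , (yi , Λ , Λi) , (yj , Λ′ , Λj)) =
    edge y i yi Λ Λi , edge y j yj Λ′ Λj , refl , (refl , inj₁ refl) ,
    (refl , inj₁ refl) , flip-flip-Adjacent-not-Lucas y adj yi yj
  from∘to : ∀ r → from (to r) ≡ r
  from∘to (e , e′ , refl , (refl , inj₁ refl) , (refl , inj₁ refl) , imb) =
    cong (λ imb → e , e′ , refl , (refl , inj₁ refl) , (refl , inj₁ refl) , imb)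
         (Bool-uip _ imb)
  from∘to (edge y _ yi Λ Λi , e′ , refl , (refl , inj₁ refl) , (refl , inj₂ up) , _) =
    ⊥-elim (upper-≢ e′ (LowerEnd-neighbour y adj (yi , Λ , Λi)) up)
  from∘to (edge y _ yi Λ Λi , e′ , refl , (refl , inj₂ up) , _) =
    ⊥-elim (upper-≢ e′ (LowerEnd-neighbour y adj (yi , Λ , Λi)) up)

LowerEnd-rotate : (y : Vec Bool n) (p : Fin n) → LowerEnd (rotate y) p ≡ LowerEnd y (cycSuc p)
LowerEnd-rotate y p
  rewrite lookup-rotate y p | updateAt-rotate y p not
        | lucasB-rotate y | lucasB-rotate (flip y (cycSuc p)) = refl

LowerEnds-rotate : (p q : Fin n) → LowerEnds n (cycSuc p) (cycSuc q) ↔ LowerEnds n p q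
LowerEnds-rotate p q = Σ-↔ rotate-↔ λ {y} →
  subst ((LowerEnd y (cycSuc p) × LowerEnd y (cycSuc q)) ↔_)
        (sym (cong₂ _×_ (LowerEnd-rotate y p) (LowerEnd-rotate y q))) ↔-refl

lucasB-false∷ : (z : Vec Bool k) → lucasB (false ∷ z) ≡ noConsec11 z
lucasB-false∷ []      = refl
lucasB-false∷ (_ ∷ z) = ∧-identityʳ _

LowerEnds-1-2↔Fib : (m : ℕ) → LowerEnds (4 + m) (suc zero) (suc (suc zero)) ↔ Fib m
LowerEnds-1-2↔Fib m = mk↔ₛ′ to from to∘from from∘to
  where
  to : LowerEnds (4 + m) (suc zero) (suc (suc zero)) → Fib m
  to (false ∷ _ ∷ _ ∷ false ∷ z , (refl , Λ , _) , (refl , _ , _)) =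
    z , trans (sym (lucasB-false∷ z)) Λ
  to (true  ∷ _ ∷ _ ∷ _     ∷ _ , (refl , _ , ()) , _)
  to (false ∷ _ ∷ _ ∷ true  ∷ _ , (refl , _ , _) , (refl , _ , ()))
  from : Fib m → LowerEnds (4 + m) (suc zero) (suc (suc zero))
  from (z , fib) = false ∷ false ∷ false ∷ false ∷ z , (refl , Λ , Λ) , (refl , Λ , Λ)
    where
    -- IsLucas of 0000z, 0100z and 0010z all reduce to this type.
    Λ : lucasB (false ∷ z) ≡ true
    Λ = trans (lucasB-false∷ z) fib
  to∘from : ∀ w → to (from w) ≡ w
  to∘from (z , fib) = cong (z ,_) (Bool-uip _ fib)
  from∘to : ∀ s → from (to s) ≡ s
  from∘to (false ∷ _ ∷ _ ∷ false ∷ _ , (refl , _ , _) , (refl , _ , _)) = LowerEnds-≡ _ _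
  from∘to (true  ∷ _ ∷ _ ∷ _     ∷ _ , (refl , _ , ()) , _)
  from∘to (false ∷ _ ∷ _ ∷ true  ∷ _ , (refl , _ , _) , (refl , _ , ()))

LowerEnds-consecutive↔Fib : (m : ℕ) {p q : Fin (4 + m)} → cycSuc p ≡ q →
                            LowerEnds (4 + m) p q ↔ Fib m
LowerEnds-consecutive↔Fib m {p} refl = cycSuc-induction P base step p
  where
  P : Fin (4 + m) → Set
  P p = LowerEnds (4 + m) p (cycSuc p) ↔ Fib m
  -- cycSuc zero and cycSuc (suc zero) compute to suc zero and suc (suc zero).
  base : P zero
  base = ↔-trans (↔-sym (LowerEnds-rotate zero (suc zero))) (LowerEnds-1-2↔Fib m)
  step : ∀ p → P p → P (cycSuc p)
  step p = ↔-trans (LowerEnds-rotate p (cycSuc p))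

mainTheorem7 : (n : ℕ) → 4 ≤ n → (i : Fin n) →
    (Rset n i ⤖ Fib (n ∸ 4)) × (Lset n i ⤖ Fib (n ∸ 4))
mainTheorem7 (suc (suc (suc (suc m)))) (s≤s (s≤s (s≤s (s≤s _)))) i =
  ↔⇒⤖ (↔-trans (ImbalancedPairs↔LowerEnds (inj₁ refl))
               (LowerEnds-consecutive↔Fib m refl)) ,
  ↔⇒⤖ (↔-trans (ImbalancedPairs↔LowerEnds (inj₂ (cycSuc-cycPred i)))
       (↔-trans LowerEnds-swap (LowerEnds-consecutive↔Fib m (cycSuc-cycPred i))))
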